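{- Let $n$ be a positive integer. The character $\mathrm{ch}(\mathcal B)=\sum_{b\in\mathcal B}x_1^{\mathrm{wt}(b)_1}\cdots x_n^{\mathrm{wt}(b)_n}$ of any finite abstract $\mathfrak q_n$-crystal $\mathcal B$ lies in $\Gamma_n$.
   Context: $\Lambda_n$ is the ring of symmetric polynomials in $\mathbb Z[x_1,\dots,x_n]$. For $n\ge2$, $\Gamma_n$ is the set of $f\in\Lambda_n$ with $f(x_1,-x_1,x_3,\dots,x_n)\in\mathbb Z[x_3,\dots,x_n]$; $\Gamma_1=\Lambda_1$. An abstract $\mathfrak{gl}_n$-crystal is a set $\mathcal B$ with $\mathrm{wt}:\mathcal B\to\mathbb Z_{\ge0}^n$ and maps $e_i,f_i:\mathcal B\to\mathcal B\sqcup\{0\}$ ($i\in\{1,\dots,n-1\}$) with $e_i(b)=c\iff f_i(c)=b$ (then $\mathrm{wt}(c)=\mathrm{wt}(b)+\mathbf e_i-\mathbf e_{i+1}$), and $\varepsilon_i(b)=\max\{k:e_i^k(b)\ne0\}$, $\varphi_i(b)=\max\{k:f_i^k(b)\ne0\}$ finite with $\varphi_i(b)-\varepsilon_i(b)=\mathrm{wt}(b)_i-\mathrm{wt}(b)_{i+1}$. For $n\ge2$ an abstract $\mathfrak q_n$-crystal is an abstract $\mathfrak{gl}_n$-crystal with extra maps $e_{\bar1},f_{\bar1}:\mathcal B\to\mathcal B\sqcup\{0\}$ such that: (1) $e_{\bar1}(b)=c\iff f_{\bar1}(c)=b$, and then $\mathrm{wt}(b)=\mathrm{wt}(c)+\mathbf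 e_2-\mathbf e_1$ and $\varepsilon_i(b)=\varepsilon_i(c)$, $\varphi_i(b)=\varphi_i(c)$ for $3\le i\le n-1$; (2) $e_{\bar1},f_{\bar1}$ commute with $e_i,f_i$ for $3\le i\le n-1$ (all operators fixing $0$); (3) $\varepsilon_{\bar1}(b)+\varphi_{\bar1}(b)\le1$ (with $\varepsilon_{\bar1},\varphi_{\bar1}$ defined analogously), with equality if $\mathrm{wt}(b)_1\ne0$ or $\mathrm{wt}(b)_2\ne0$. An abstract $\mathfrak q_1$-crystal is any set with a weight map to $\mathbb Z_{\ge0}$. -}

module Defs where

open import Data.Nat as ℕ using (ℕ; zero; suc; _≤_; _<_; _+_)
open import Data.Integer as ℤ using (ℤ; +_; -_; _-_)
open import Data.Fin using (Fin; toℕ)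
open import Data.Fin.Properties using (all?)
open import Data.Fin.Permutation using (Permutation′; _⟨$⟩ʳ_)
open import Data.Maybe using (Maybe; just; nothing; _>>=_)
open import Data.List using (List; map; foldr; upTo; allFin)
open import Data.Nat.ListAction using (sum)
open import Data.Vec.Functional using (_∷_)
open import Data.Product using (Σ; _×_)
open import Data.Sum using (_⊎_)
open import Data.Unit using (⊤)
open import Data.Empty using (⊥)
open import Data.Bool using (if_then_else_)
open import Relation.Nullary using (¬_; Dec; does)
open import Relation.Binary.PropositionalEquality using (_≡_; _≢_)
open import Function.Bundles using (_⇔_)

-- Weights / exponent vectors: Fin n → ℕ  (index j : Fin n is x_{j+1}).

-- component at a natural-number index (0 when out of range)
_!_ : ∀ {n} → (Fin n → ℕ) → ℕ → ℕ
_!_ {zero}  w k       = 0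
_!_ {suc n} w zero    = w Fin.zero where import Data.Fin as Fin
_!_ {suc n} w (suc k) = (λ j → w (Fin.suc j)) ! k where import Data.Fin as Fin

δ : ∀ {n} → Fin n → ℕ → ℤ
δ j k = if does (toℕ j ℕ.≟ k) then + 1 else + 0

-- Step i u v :  v = u + e_{i+1} - e_{i+2}   (operator index i is 0-based,
-- i.e. i here corresponds to the paper's i+1)
Step : ∀ {n} → ℕ → (Fin n → ℕ) → (Fin n → ℕ) → Set
Step i u v = ∀ j → + v j ≡ (+ u j ℤ.+ δ j i) - δ j (suc i)

-- iterate a partial operator:  iter g k b = g^k(b)   (nothing = 0)
iter : {B : Set} → (B → Maybe B) → ℕ → B → Maybe B
iter g zero    b = just b
iter g (suc k) b = iter g k b >>= g

IsMaxIter : {B : Set} → (B → Maybe B) → B → ℕ → Set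
IsMaxIter g b k = (iter g k b ≢ nothing) × (iter g (suc k) b ≡ nothing)

-- Abstract gl_n-crystal structure on B with weight map wt.
-- Operator indices i : ℕ with suc i < n  (0-based: paper's i = our i + 1).

record GLCrystal (n : ℕ) (B : Set) (wt : B → Fin n → ℕ) : Set where
  field
    e f   : ℕ → B → Maybe B
    ε φ   : ℕ → B → ℕ
    ef    : ∀ i → suc i < n → ∀ b c → (e i b ≡ just c) ⇔ (f i c ≡ just b)
    e-wt  : ∀ i → suc i < n → ∀ b c → e i b ≡ just c → Step i (wt b) (wt c)
    ε-max : ∀ i → suc i < n → ∀ b → IsMaxIter (e i) b (ε i b)
    φ-max : ∀ i → suc i < n → ∀ b → IsMaxIter (f i) b (φ i b)
    φ-ε   : ∀ i → suc i < n → ∀ b →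
            (+ φ i b) - (+ ε i b) ≡ (+ (wt b ! i)) - (+ (wt b ! suc i))

_⊙_ : {B : Set} → (B → Maybe B) → (B → Maybe B) → B → Maybe B
(g ⊙ h) b = h b >>= g

record QExtra (n : ℕ) (B : Set) (wt : B → Fin n → ℕ) (G : GLCrystal n B wt) : Set where
  open GLCrystal G
  field
    e̅ f̅   : B → Maybe B
    ε̅ φ̅   : B → ℕ
    e̅f̅     : ∀ b c → (e̅ b ≡ just c) ⇔ (f̅ c ≡ just b)
    e̅-wt   : ∀ b c → e̅ b ≡ just c → Step 0 (wt b) (wt c)
    e̅-ε    : ∀ b c → e̅ b ≡ just c → ∀ i → 2 ≤ i → suc i < n → ε i b ≡ ε i c
    e̅-φ    : ∀ b c → e̅ b ≡ just c → ∀ i → 2 ≤ i → suc i < n → φ i b ≡ φ i c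
    comm-e̅e : ∀ i → 2 ≤ i → suc i < n → ∀ b → (e̅ ⊙ e i) b ≡ (e i ⊙ e̅) b
    comm-e̅f : ∀ i → 2 ≤ i → suc i < n → ∀ b → (e̅ ⊙ f i) b ≡ (f i ⊙ e̅) b
    comm-f̅e : ∀ i → 2 ≤ i → suc i < n → ∀ b → (f̅ ⊙ e i) b ≡ (e i ⊙ f̅) b
    comm-f̅f : ∀ i → 2 ≤ i → suc i < n → ∀ b → (f̅ ⊙ f i) b ≡ (f i ⊙ f̅) b
    ε̅-max  : ∀ b → IsMaxIter e̅ b (ε̅ b)
    φ̅-max  : ∀ b → IsMaxIter f̅ b (φ̅ b)
    ε̅φ̅≤1   : ∀ b → ε̅ b + φ̅ b ≤ 1
    ε̅φ̅≡1   : ∀ b → (wt b ! 0 ≢ 0) ⊎ (wt b ! 1 ≢ 0) → ε̅ b + φ̅ b ≡ 1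

QCrystal : (n : ℕ) (B : Set) → (B → Fin n → ℕ) → Set
QCrystal zero                B wt = ⊥
QCrystal (suc zero)          B wt = ⊤
QCrystal n@(suc (suc m))     B wt = Σ (GLCrystal n B wt) (QExtra n B wt)

Poly : ℕ → Set
Poly n = (Fin n → ℕ) → ℤ

_≟w_ : ∀ {n} (u v : Fin n → ℕ) → Dec (∀ j → u j ≡ v j)
u ≟w v = all? (λ j → u j ℕ.≟ v j)

ch : ∀ {n m} → (Fin m → Fin n → ℕ) → Poly n
ch {m = m} wt a = + sum (map (λ b → if does (wt b ≟w a) then 1 else 0) (allFin m))

IsSymmetric : ∀ {n} → Poly n → Set
IsSymmetric {n} p = ∀ (σ : Permutation′ n) (a : Fin n → ℕ) → p (λ j → a (σ ⟨$⟩ʳ j)) ≡ p a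

sgn : ℕ → ℤ
sgn zero          = + 1
sgn (suc zero)    = - (+ 1)
sgn (suc (suc k)) = sgn k

-- coefficient of x_1^k x_3^{c_3} ... x_n^{c_n} in p(x_1, -x_1, x_3, ..., x_n):
--   Σ_{a=0}^{k} (-1)^{k-a} [x_1^a x_2^{k-a} x^c] p
substCoeff : ∀ {m} → Poly (suc (suc m)) → ℕ → (Fin m → ℕ) → ℤ
substCoeff p k c =
  foldr ℤ._+_ (+ 0) (map (λ a → sgn (k ℕ.∸ a) ℤ.* p (a ∷ (k ℕ.∸ a) ∷ c)) (upTo (suc k)))

InΓ : (n : ℕ) → Poly n → Set
InΓ zero             p = IsSymmetric p
InΓ (suc zero)       p = IsSymmetric p
InΓ (suc (suc m))    p = IsSymmetric p ×
  -- p(x_1,-x_1,x_3,...,x_n) has no monomial with positive x_1-degree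
  (∀ (k : ℕ) (c : Fin m → ℕ) → substCoeff p (suc k) c ≡ + 0)

module Submission where

-- Write N(a) for the number of elements of weight a, so that ch = Σ_a N(a) x^a.
--
-- The reflection along the i-string, b ↦ f_i^{φ_i b − ε_i b} b
-- (or e_i^{ε_i b − φ_i b} b when the exponent is negative), is injective and
-- sends weight a to s_i a, the weight with coordinates i, i+1 exchanged.
-- Hence N(a) ≤ N(s_i a) ≤ N(a), and a polynomial invariant under all adjacent
-- transpositions is invariant under every permutation.
--
-- The coefficient of x_1^K x^c in ch(x_1,−x_1,x_3,…) is
-- Σ_{a=0}^{K} (−1)^{K−a} N(a, K−a, c).  For K > 0 every element of such a
-- weight has exactly one of e̅ b, f̅ b defined, so N = Up + Down.  The partial
-- bijection e̅ gives Up(a) = Down(a+1), while Up(K) = Down(0) = 0 because e̅, f̅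
-- would leave ℕ^n; the alternating sum therefore telescopes to 0.

open import Defs
open import Data.Nat as ℕ using (ℕ; zero; suc; _≤_; _<_; _∸_; z≤n; s≤s; _≤′_; ≤′-refl; ≤′-step)
import Data.Nat.Properties as ℕP
open import Data.Integer using (ℤ; +_; -[1+_]; _+_; _-_; _*_; -_)
import Data.Integer.Properties as ℤP
open import Data.Integer.Solver using (module +-*-Solver)
open import Data.Fin using (Fin; zero; suc; punchIn; punchOut)
open import Data.Fin.Properties using (punchIn-punchOut; punchOut-injective; suc-injective)
open import Data.Fin.Permutation using (Permutation′; _⟨$⟩ʳ_; remove; punchIn-permute)
open import Data.Vec.Functional using (_∷_; tail)
open import Data.List using (map; foldr; applyUpTo; tabulate)
open import Data.Nat.ListAction using (sum)
open import Data.Maybe using (Maybe; just; nothing; _>>=_; is-just)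
open import Data.Bool using (Bool; true; false; _∧_; not; if_then_else_)
open import Data.Product using (_×_; _,_; proj₁; proj₂; ∃-syntax)
open import Data.Sum using (_⊎_; inj₁; inj₂)
open import Data.Empty using (⊥-elim)
open import Relation.Nullary using (Dec; yes; no; does)
open import Relation.Nullary.Decidable using (dec-true)
open import Relation.Binary.PropositionalEquality
open import Function.Bundles using (Equivalence; mk⇔; _⇔_)
open import Algebra.Properties.CommutativeSemigroup ℕP.+-commutativeSemigroup using (x∙yz≈y∙xz)
open +-*-Solver

-- Counting in finite sets

indicator : Bool → ℕ
indicator x = if x then 1 else 0

count : ∀ {m} → (Fin m → Bool) → ℕ
count {zero}  P = 0
count {suc m} P = indicator (P zero) ℕ.+ count (tail P)

sum-tabulate : ∀ {A : Set} {m} (P : A → Bool) (h : Fin m → A) →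
               sum (map (λ b → indicator (P b)) (tabulate h)) ≡ count (λ k → P (h k))
sum-tabulate {m = zero}  P h = refl
sum-tabulate {m = suc m} P h = cong (indicator (P (h zero)) ℕ.+_) (sum-tabulate P (λ k → h (suc k)))

count-cong : ∀ {m} (P Q : Fin m → Bool) → (∀ b → P b ≡ Q b) → count P ≡ count Q
count-cong {zero}  P Q eq = refl
count-cong {suc m} P Q eq = cong₂ ℕ._+_ (cong indicator (eq zero)) (count-cong _ _ (λ b → eq (suc b)))

count-empty : ∀ {m} (P : Fin m → Bool) → (∀ b → P b ≡ false) → count P ≡ 0
count-empty {zero}  P none = refl
count-empty {suc m} P none rewrite none zero = count-empty _ (λ b → none (suc b))

count-split : ∀ {m} (P Y : Fin m → Bool) →
              count P ≡ count (λ b → P b ∧ Y b) ℕ.+ count (λ b → P b ∧ not (Y b))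
count-split {zero}  P Y = refl
count-split {suc m} P Y with P zero | Y zero
... | false | _     = count-split (tail P) (tail Y)
... | true  | true  = cong suc (count-split (tail P) (tail Y))
... | true  | false = trans (cong suc (count-split (tail P) (tail Y))) (sym (ℕP.+-suc _ _))

count-punchIn : ∀ {m} (P : Fin (suc m) → Bool) t →
                count P ≡ indicator (P t) ℕ.+ count (λ k → P (punchIn t k))
count-punchIn P zero = refl
count-punchIn {suc m} P (suc t) =
  trans (cong (indicator (P zero) ℕ.+_) (count-punchIn (tail P) t))
        (x∙yz≈y∙xz (indicator (P zero)) (indicator (P (suc t))) _)

count-≤-injection : ∀ {m₁ m₂} (P : Fin m₁ → Bool) (Q : Fin m₂ → Bool)
                    (g : ∀ b → P b ≡ true → Fin m₂) → (∀ b pb → Q (g b pb) ≡ true) →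
                    (∀ b b′ pb pb′ → g b pb ≡ g b′ pb′ → b ≡ b′) → count P ≤ count Q
count-≤-injection {zero} P Q g lands inj = z≤n
count-≤-injection {suc m₁} P Q g lands inj with P zero in p₀
... | false = count-≤-injection (tail P) Q (λ b pb → g (suc b) pb) (λ b pb → lands (suc b) pb)
                (λ b b′ pb pb′ eq → suc-injective (inj _ _ pb pb′ eq))
count-≤-injection {suc m₁} {zero} P Q g lands inj | true with g zero p₀
... | ()
count-≤-injection {suc m₁} {suc m₂} P Q g lands inj | true =
  ℕP.≤-trans (s≤s rest)
    (ℕP.≤-reflexive (sym (trans (count-punchIn Q t)
                                (cong (λ x → indicator x ℕ.+ count Q∖t) (lands zero p₀)))))
  where
  t : Fin (suc m₂)
  t = g zero p₀
  Q∖t : Fin m₂ → Bool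
  Q∖t k = Q (punchIn t k)
  -- the images of the other P-elements avoid t, so they live in Q minus t
  avoid : ∀ b pb → t ≢ g (suc b) pb
  avoid b pb eq with inj zero (suc b) p₀ pb eq
  ... | ()
  rest : count (tail P) ≤ count Q∖t
  rest = count-≤-injection (tail P) Q∖t
           (λ b pb → punchOut (avoid b pb))
           (λ b pb → trans (cong Q (punchIn-punchOut (avoid b pb))) (lands (suc b) pb))
           (λ b b′ pb pb′ eq →
              suc-injective (inj _ _ pb pb′ (punchOut-injective (avoid b pb) (avoid b′ pb′) eq)))

PartialInjective : {B : Set} → (B → Maybe B) → Set
PartialInjective g = ∀ b b′ c → g b ≡ just c → g b′ ≡ just c → b ≡ b′

∧-elim : ∀ {x y} → x ∧ y ≡ true → x ≡ true × y ≡ true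
∧-elim {true} {true} _ = refl , refl

∧-intro : ∀ {x y} → x ≡ true → y ≡ true → x ∧ y ≡ true
∧-intro refl refl = refl

count-≤-partial : ∀ {m} (P Q : Fin m → Bool) (g : Fin m → Maybe (Fin m)) → PartialInjective g →
                  (∀ b → P b ≡ true → ∃[ c ] (g b ≡ just c × Q c ≡ true)) → count P ≤ count Q
count-≤-partial P Q g inj lands =
  count-≤-injection P Q (λ b pb → proj₁ (lands b pb)) (λ b pb → proj₂ (proj₂ (lands b pb)))
    (λ b b′ pb pb′ eq → inj b b′ _ (trans (proj₁ (proj₂ (lands b pb))) (cong just eq))
                                   (proj₁ (proj₂ (lands b′ pb′))))

-- Symmetry from adjacent transpositions

-- swapAt i a exchanges the coordinates i and i+1 of an exponent vector
-- (the identity when i+1 is out of range).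
swapAt : ℕ → ∀ {n} → (Fin n → ℕ) → Fin n → ℕ
swapAt zero    {suc (suc n)} a = a (suc zero) ∷ a zero ∷ (λ k → a (suc (suc k)))
swapAt (suc i) {suc n}       a = a zero ∷ swapAt i (tail a)
swapAt _                     a = a

swapAt-involutive : ∀ i {n} (a : Fin n → ℕ) j → swapAt i (swapAt i a) j ≡ a j
swapAt-involutive zero    {suc (suc n)} a zero          = refl
swapAt-involutive zero    {suc (suc n)} a (suc zero)    = refl
swapAt-involutive zero    {suc (suc n)} a (suc (suc j)) = refl
swapAt-involutive zero    {zero}        a j             = refl
swapAt-involutive zero    {suc zero}    a j             = refl
swapAt-involutive (suc i) {zero}        a j             = refl
swapAt-involutive (suc i) {suc n}       a zero          = refl
swapAt-involutive (suc i) {suc n}       a (suc j)       = swapAt-involutive i (tail a) j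

Respects : ∀ {n} → Poly n → Set
Respects p = ∀ a b → (∀ j → a j ≡ b j) → p a ≡ p b

SwapInvariant : ∀ {n} → Poly n → Set
SwapInvariant {n} p = ∀ i → suc i < n → ∀ a → p (swapAt i a) ≡ p a

fix-head : ∀ {n} (p : Poly (suc n)) x → Respects p → SwapInvariant p →
           Respects (λ b → p (x ∷ b)) × SwapInvariant (λ b → p (x ∷ b))
fix-head p x resp inv =
  (λ a b eq → resp _ _ (λ { zero → refl ; (suc j) → eq j })) ,
  (λ i i<n a → inv (suc i) (s≤s i<n) (x ∷ a))

move-to-front : ∀ {n} (p : Poly (suc n)) → Respects p → SwapInvariant p →
                ∀ j a → p a ≡ p (a j ∷ (λ k → a (punchIn j k)))
move-to-front p resp inv zero a = resp _ _ (λ { zero → refl ; (suc j) → refl })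
move-to-front {suc n} p resp inv (suc j) a = begin
  p a
    ≡⟨ resp _ _ (λ { zero → refl ; (suc k) → refl }) ⟩
  p (a zero ∷ tail a)
    ≡⟨ move-to-front (λ b → p (a zero ∷ b)) resp′ inv′ j (tail a) ⟩
  p (a zero ∷ a (suc j) ∷ rest)
    ≡⟨ sym (inv 0 (s≤s (s≤s z≤n)) _) ⟩
  p (swapAt 0 (a zero ∷ a (suc j) ∷ rest))
    ≡⟨ resp _ _ (λ { zero → refl ; (suc zero) → refl ; (suc (suc k)) → refl }) ⟩
  p (a (suc j) ∷ (λ k → a (punchIn (suc j) k))) ∎
  where
  open ≡-Reasoning
  rest : Fin n → ℕ
  rest k = a (suc (punchIn j k))
  resp′ : Respects (λ b → p (a zero ∷ b))
  resp′ = proj₁ (fix-head p (a zero) resp inv)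
  inv′ : SwapInvariant (λ b → p (a zero ∷ b))
  inv′ = proj₂ (fix-head p (a zero) resp inv)

-- A polynomial invariant under adjacent transpositions is symmetric:
-- move σ(0) to the front and recurse on the remaining permutation.
swapInvariant⇒symmetric : ∀ {n} (p : Poly n) → Respects p → SwapInvariant p → IsSymmetric p
swapInvariant⇒symmetric {zero} p resp inv σ a = resp _ _ (λ ())
swapInvariant⇒symmetric {suc n} p resp inv σ a = begin
  p (λ j → a (σ ⟨$⟩ʳ j))
    ≡⟨ resp _ _ (λ { zero → refl ; (suc k) → cong a (punchIn-permute σ zero k) }) ⟩
  p (a j₀ ∷ (λ k → rest (τ ⟨$⟩ʳ k)))
    ≡⟨ swapInvariant⇒symmetric (λ b → p (a j₀ ∷ b)) resp′ inv′ τ rest ⟩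
  p (a j₀ ∷ rest)
    ≡⟨ sym (move-to-front p resp inv j₀ a) ⟩
  p a ∎
  where
  open ≡-Reasoning
  j₀ : Fin (suc n)
  j₀ = σ ⟨$⟩ʳ zero
  τ : Permutation′ n
  τ = remove zero σ
  rest : Fin n → ℕ
  rest k = a (punchIn j₀ k)
  resp′ : Respects (λ b → p (a j₀ ∷ b))
  resp′ = proj₁ (fix-head p (a j₀) resp inv)
  inv′ : SwapInvariant (λ b → p (a j₀ ∷ b))
  inv′ = proj₂ (fix-head p (a j₀) resp inv)

just-injective : ∀ {A : Set} {x y : A} → just x ≡ just y → x ≡ y
just-injective refl = refl

module _ {B : Set} where

  PartialInverse : (B → Maybe B) → (B → Maybe B) → Set
  PartialInverse g h = ∀ b c → (g b ≡ just c) ⇔ (h c ≡ just b)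

  inverse-sym : ∀ (g h : B → Maybe B) → PartialInverse g h → PartialInverse h g
  inverse-sym g h inverse c b = mk⇔ (Equivalence.from (inverse b c)) (Equivalence.to (inverse b c))

  inverse⇒injective : ∀ (g h : B → Maybe B) → PartialInverse g h → PartialInjective g
  inverse⇒injective g h inverse b b′ c gb gb′ =
    just-injective (trans (sym (Equivalence.to (inverse b c) gb)) (Equivalence.to (inverse b′ c) gb′))

  iter-injective : ∀ (g : B → Maybe B) → PartialInjective g → ∀ k → PartialInjective (iter g k)
  iter-injective g inj zero b b′ c refl refl = refl
  iter-injective g inj (suc k) b b′ c gᵏ⁺¹b gᵏ⁺¹b′ with iter g k b in gᵏb | iter g k b′ in gᵏb′
  ... | just x | just x′ =
    iter-injective g inj k b b′ x gᵏb (trans gᵏb′ (cong just (inj x′ x c gᵏ⁺¹b′ gᵏ⁺¹b)))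

  iter-defined-below : ∀ (g : B → Maybe B) b {k K} → k ≤′ K →
                       iter g K b ≢ nothing → iter g k b ≢ nothing
  iter-defined-below g b ≤′-refl defined = defined
  iter-defined-below g b (≤′-step {K} k≤K) defined = iter-defined-below g b k≤K previous
    where
    previous : iter g K b ≢ nothing
    previous undefined = defined (cong (_>>= g) undefined)

  maxIter-defined : ∀ (g : B → Maybe B) b k → IsMaxIter g b k → is-just (g b) ≡ (1 ℕ.≤ᵇ k)
  maxIter-defined g b zero (_ , g¹b) rewrite g¹b = refl
  maxIter-defined g b (suc k) (gᵏb , _) with g b in gb
  ... | just _  = refl
  ... | nothing = ⊥-elim (iter-defined-below g b {1} {suc k} (ℕP.≤⇒≤′ (s≤s z≤n)) gᵏb gb)

  is-just⇒just : (x : Maybe B) → is-just x ≡ true → ∃[ c ] x ≡ just c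
  is-just⇒just (just c) _ = c , refl

  defined⇒just : (x : Maybe B) → x ≢ nothing → ∃[ c ] x ≡ just c
  defined⇒just (just c) _       = c , refl
  defined⇒just nothing  defined = ⊥-elim (defined refl)

root : ∀ {n} → ℕ → Fin n → ℤ
root i j = δ j i - δ j (suc i)

shift-back : ∀ x y v → y ≡ x + v → x ≡ y + - v
shift-back x y v eq = trans (solve 2 (λ x v → x := (x :+ v) :+ :- v) refl x v) (cong (_+ - v) (sym eq))

module _ {n} {B : Set} (wt : B → Fin n → ℕ) where

  Shifts : (B → Maybe B) → (Fin n → ℤ) → Set
  Shifts g v = ∀ b c → g b ≡ just c → ∀ j → + wt c j ≡ + wt b j + v j

  shifts-cong : ∀ g v v′ → (∀ j → v j ≡ v′ j) → Shifts g v → Shifts g v′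
  shifts-cong g v v′ eq sh b c gb j = trans (sh b c gb j) (cong (λ t → + wt b j + t) (eq j))

  step⇒shifts : ∀ g i → (∀ b c → g b ≡ just c → Step i (wt b) (wt c)) → Shifts g (root i)
  step⇒shifts g i step b c gb j = trans (step b c gb j) (ℤP.+-assoc (+ wt b j) (δ j i) (- δ j (suc i)))

  inverse-shifts : ∀ g h v → PartialInverse g h → Shifts g v → Shifts h (λ j → - v j)
  inverse-shifts g h v inverse sh c b hc j =
    shift-back (+ wt b j) (+ wt c j) (v j) (sh b c (Equivalence.from (inverse b c) hc) j)

  iter-shifts : ∀ g v → Shifts g v → ∀ k → Shifts (iter g k) (λ j → + k * v j)
  iter-shifts g v sh zero b .b refl j =
    sym (trans (cong (λ t → + wt b j + t) (ℤP.*-zeroˡ (v j))) (ℤP.+-identityʳ _))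
  iter-shifts g v sh (suc k) b c gᵏ⁺¹b j with iter g k b in gᵏb
  ... | just c′ = begin
    + wt c j                      ≡⟨ sh c′ c gᵏ⁺¹b j ⟩
    + wt c′ j + v j               ≡⟨ cong (_+ v j) (iter-shifts g v sh k b c′ gᵏb j) ⟩
    (+ wt b j + + k * v j) + v j  ≡⟨ solve 3 (λ x k v → (x :+ k :* v) :+ v := x :+ (con (+ 1) :+ k) :* v)
                                             refl (+ wt b j) (+ k) (v j) ⟩
    + wt b j + + suc k * v j      ∎
    where open ≡-Reasoning

  shift-lands : ∀ g v → Shifts g v → ∀ (a a′ : Fin n → ℕ) → (∀ j → + a′ j ≡ + a j + v j) →
                ∀ b c → (∀ j → wt b j ≡ a j) → g b ≡ just c → ∀ j → wt c j ≡ a′ j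
  shift-lands g v sh a a′ a′≡a+v b c wb gb j =
    ℤP.+-injective (trans (sh b c gb j) (trans (cong (λ t → + t + v j) (wb j)) (sym (a′≡a+v j))))

  shift-blocked : ∀ g v → Shifts g v → ∀ b j k → + wt b j + v j ≡ -[1+ k ] → g b ≡ nothing
  shift-blocked g v sh b j k negative with g b in gb
  ... | nothing = refl
  ... | just c  = ⊥-elim (nonneg (trans (sh b c gb j) negative))
    where
    nonneg : ∀ {x} → + x ≢ -[1+ k ]
    nonneg ()

does-true : ∀ {P : Set} (p? : Dec P) → does p? ≡ true → P
does-true (yes p) _ = p

does-⇔ : ∀ {P Q : Set} (p? : Dec P) (q? : Dec Q) → (P → Q) → (Q → P) → does p? ≡ does q?
does-⇔ (yes _) (yes _) _   _   = refl
does-⇔ (no _)  (no _)  _   _   = refl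
does-⇔ (yes p) (no ¬q) p→q _   = ⊥-elim (¬q (p→q p))
does-⇔ (no ¬p) (yes q) _   q→p = ⊥-elim (¬p (q→p q))

index-cong : ∀ {n} (u v : Fin n → ℕ) → (∀ j → u j ≡ v j) → ∀ k → u ! k ≡ v ! k
index-cong {zero}  u v eq k       = refl
index-cong {suc n} u v eq zero    = eq zero
index-cong {suc n} u v eq (suc k) = index-cong (tail u) (tail v) (λ j → eq (suc j)) k

module _ {n m} (wt : Fin m → Fin n → ℕ) where

  fibre : (Fin n → ℕ) → Fin m → Bool
  fibre a b = does (wt b ≟w a)

  fibre-weight : ∀ a b → fibre a b ≡ true → ∀ j → wt b j ≡ a j
  fibre-weight a b = does-true (wt b ≟w a)

  fibre-intro : ∀ a b → (∀ j → wt b j ≡ a j) → fibre a b ≡ true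
  fibre-intro a b = dec-true (wt b ≟w a)

  fibre-cong : ∀ a a′ → (∀ j → a j ≡ a′ j) → ∀ b → fibre a b ≡ fibre a′ b
  fibre-cong a a′ eq b = does-⇔ (wt b ≟w a) (wt b ≟w a′)
    (λ wb j → trans (wb j) (eq j)) (λ wb′ j → trans (wb′ j) (sym (eq j)))

  ch-as-count : ∀ a → ch wt a ≡ + count (fibre a)
  ch-as-count a = cong +_ (sum-tabulate (fibre a) (λ b → b))

  ch-respects : Respects (ch wt)
  ch-respects a a′ eq = begin
    ch wt a               ≡⟨ ch-as-count a ⟩
    + count (fibre a)     ≡⟨ cong +_ (count-cong _ _ (fibre-cong a a′ eq)) ⟩
    + count (fibre a′)    ≡⟨ sym (ch-as-count a′) ⟩
    ch wt a′              ∎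
    where open ≡-Reasoning

  defined-fibre-≤ : ∀ g h v → PartialInverse g h → Shifts wt g v →
                    ∀ a a′ → (∀ j → + a′ j ≡ + a j + v j) →
                    count (λ b → fibre a b ∧ is-just (g b)) ≤ count (λ c → fibre a′ c ∧ is-just (h c))
  defined-fibre-≤ g h v inverse sh a a′ a′≡a+v =
    count-≤-partial _ _ g (inverse⇒injective g h inverse) lands
    where
    lands : ∀ b → fibre a b ∧ is-just (g b) ≡ true →
            ∃[ c ] (g b ≡ just c × fibre a′ c ∧ is-just (h c) ≡ true)
    lands b pb = c , gb≡c , ∧-intro
      (fibre-intro a′ c
        (shift-lands wt g v sh a a′ a′≡a+v b c (fibre-weight a b (proj₁ (∧-elim pb))) gb≡c))
      (cong is-just (Equivalence.to (inverse b c) gb≡c))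
      where
      image : ∃[ c ] g b ≡ just c
      image = is-just⇒just (g b) (proj₂ (∧-elim pb))
      c : Fin m
      c = proj₁ image
      gb≡c : g b ≡ just c
      gb≡c = proj₂ image

  count-undefined : ∀ (P : Fin m → Bool) (g : Fin m → Maybe (Fin m)) →
                    (∀ b → P b ≡ true → g b ≡ nothing) → count (λ b → P b ∧ is-just (g b)) ≡ 0
  count-undefined P g undefined = count-empty _ none
    where
    none : ∀ b → P b ∧ is-just (g b) ≡ false
    none b with P b in pb
    ... | false = refl
    ... | true  rewrite undefined b pb = refl

-- The character is symmetric

gap : ∀ {n} → ℕ → (Fin n → ℕ) → ℤ
gap i a = + (a ! i) - + (a ! suc i)

swapAt-shift : ∀ i {n} → suc i < n → ∀ (a : Fin n → ℕ) j →
               + swapAt i a j ≡ + a j + (- gap i a) * root i j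
swapAt-shift zero {suc (suc n)} _ a zero =
  solve 2 (λ x y → y := x :+ (:- (x :- y)) :* (con (+ 1) :- con (+ 0))) refl (+ a zero) (+ a (suc zero))
swapAt-shift zero {suc (suc n)} _ a (suc zero) =
  solve 2 (λ x y → x := y :+ (:- (x :- y)) :* (con (+ 0) :- con (+ 1))) refl (+ a zero) (+ a (suc zero))
swapAt-shift zero {suc (suc n)} _ a (suc (suc j)) =
  solve 3 (λ x y z → z := z :+ (:- (x :- y)) :* (con (+ 0) :- con (+ 0)))
          refl (+ a zero) (+ a (suc zero)) (+ a (suc (suc j)))
swapAt-shift zero {suc zero} (s≤s ()) a j
swapAt-shift (suc i) {suc n} _ a zero =
  solve 3 (λ x y z → z := z :+ (:- (x :- y)) :* (con (+ 0) :- con (+ 0)))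
          refl (+ (a ! suc i)) (+ (a ! suc (suc i))) (+ a zero)
swapAt-shift (suc i) {suc n} (s≤s i<n) a (suc j) = swapAt-shift i i<n (tail a) j

difference-nonneg : ∀ x y k → + x - + y ≡ + k → x ≡ k ℕ.+ y
difference-nonneg x y k eq =
  ℤP.+-injective (trans (solve 2 (λ x y → x := (x :- y) :+ y) refl (+ x) (+ y)) (cong (_+ + y) eq))

difference-neg : ∀ x y k → + x - + y ≡ -[1+ k ] → y ≡ suc k ℕ.+ x
difference-neg x y k eq = trans
  (ℤP.+-injective (trans (solve 2 (λ x y → y := x :- (x :- y)) refl (+ x) (+ y)) (cong (λ t → + x - t) eq)))
  (ℕP.+-comm x (suc k))

module _ {n m} (wt : Fin m → Fin n → ℕ) (G : GLCrystal n (Fin m) wt) (i : ℕ) (i<n : suc i < n) where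
  open GLCrystal G

  e-shifts : Shifts wt (e i) (root i)
  e-shifts = step⇒shifts wt (e i) i (e-wt i i<n)

  f-shifts : Shifts wt (f i) (λ j → - root i j)
  f-shifts = inverse-shifts wt (e i) (f i) (root i) (ef i i<n) e-shifts

  reflect : ℤ → Fin m → Maybe (Fin m)
  reflect (+ k)    = iter (f i) k
  reflect -[1+ k ] = iter (e i) (suc k)

  reflect-shifts : ∀ z → Shifts wt (reflect z) (λ j → (- z) * root i j)
  reflect-shifts (+ k) = shifts-cong wt (iter (f i) k) (λ j → + k * - root i j) (λ j → - + k * root i j)
    (λ j → solve 2 (λ k r → k :* (:- r) := (:- k) :* r) refl (+ k) (root i j))
    (iter-shifts wt (f i) (λ j → - root i j) f-shifts k)
  reflect-shifts -[1+ k ] = iter-shifts wt (e i) (root i) e-shifts (suc k)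

  reflect-injective : ∀ z → PartialInjective (reflect z)
  reflect-injective (+ k)    =
    iter-injective (f i) (inverse⇒injective (f i) (e i) (inverse-sym (e i) (f i) (ef i i<n))) k
  reflect-injective -[1+ k ] = iter-injective (e i) (inverse⇒injective (e i) (f i) (ef i i<n)) (suc k)

  reflect-defined : ∀ z b → + φ i b - + ε i b ≡ z → reflect z b ≢ nothing
  reflect-defined (+ k) b eq = iter-defined-below (f i) b (ℕP.≤⇒≤′ k≤φ) (proj₁ (φ-max i i<n b))
    where
    k≤φ : k ≤ φ i b
    k≤φ = subst (k ≤_) (sym (difference-nonneg (φ i b) (ε i b) k eq)) (ℕP.m≤m+n k _)
  reflect-defined -[1+ k ] b eq = iter-defined-below (e i) b (ℕP.≤⇒≤′ k<ε) (proj₁ (ε-max i i<n b))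
    where
    k<ε : suc k ≤ ε i b
    k<ε = subst (suc k ≤_) (sym (difference-neg (φ i b) (ε i b) k eq)) (ℕP.m≤m+n (suc k) _)

  fibre-gap : ∀ a b → fibre wt a b ≡ true → + φ i b - + ε i b ≡ gap i a
  fibre-gap a b inFibre = trans (φ-ε i i<n b)
    (cong₂ (λ x y → + x - + y) (index-cong _ _ wb i) (index-cong _ _ wb (suc i)))
    where
    wb : ∀ j → wt b j ≡ a j
    wb = fibre-weight wt a b inFibre

  -- the reflection maps the fibre of a injectively into the fibre of s_i a
  fibre-≤-swapped : ∀ a → count (fibre wt a) ≤ count (fibre wt (swapAt i a))
  fibre-≤-swapped a = count-≤-partial _ _ (reflect (gap i a)) (reflect-injective (gap i a)) lands
    where
    lands : ∀ b → fibre wt a b ≡ true →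
            ∃[ c ] (reflect (gap i a) b ≡ just c × fibre wt (swapAt i a) c ≡ true)
    lands b inFibre = c , rb≡c ,
      fibre-intro wt _ c
        (shift-lands wt (reflect (gap i a)) (λ j → (- gap i a) * root i j) (reflect-shifts (gap i a))
          a (swapAt i a) (swapAt-shift i i<n a) b c (fibre-weight wt a b inFibre) rb≡c)
      where
      image : ∃[ c ] reflect (gap i a) b ≡ just c
      image = defined⇒just (reflect (gap i a) b) (reflect-defined (gap i a) b (fibre-gap a b inFibre))
      c : Fin m
      c = proj₁ image
      rb≡c : reflect (gap i a) b ≡ just c
      rb≡c = proj₂ image

  ch-swapAt : ∀ a → ch wt (swapAt i a) ≡ ch wt a
  ch-swapAt a = begin
    ch wt (swapAt i a)                   ≡⟨ ch-as-count wt (swapAt i a) ⟩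
    + count (fibre wt (swapAt i a))      ≡⟨ cong +_ (ℕP.≤-antisym back (fibre-≤-swapped a)) ⟩
    + count (fibre wt a)                 ≡⟨ sym (ch-as-count wt a) ⟩
    ch wt a                              ∎
    where
    open ≡-Reasoning
    back : count (fibre wt (swapAt i a)) ≤ count (fibre wt a)
    back = ℕP.≤-trans (fibre-≤-swapped (swapAt i a))
             (ℕP.≤-reflexive (count-cong _ _ (fibre-cong wt _ _ (swapAt-involutive i a))))

ch-swapInvariant : ∀ {n m} (wt : Fin m → Fin n → ℕ) → GLCrystal n (Fin m) wt → SwapInvariant (ch wt)
ch-swapInvariant wt G i i<n = ch-swapAt wt G i i<n

-- Alternating telescoping sums

sumTo : (ℕ → ℤ) → ℕ → ℤ
sumTo h zero    = + 0
sumTo h (suc N) = h 0 + sumTo (λ a → h (suc a)) N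

sumTo-cong : ∀ h h′ N → (∀ a → h a ≡ h′ a) → sumTo h N ≡ sumTo h′ N
sumTo-cong h h′ zero    eq = refl
sumTo-cong h h′ (suc N) eq = cong₂ _+_ (eq 0) (sumTo-cong _ _ N (λ a → eq (suc a)))

foldr-applyUpTo : ∀ (h : ℕ → ℤ) (g : ℕ → ℕ) N →
                  foldr _+_ (+ 0) (map h (applyUpTo g N)) ≡ sumTo (λ a → h (g a)) N
foldr-applyUpTo h g zero    = refl
foldr-applyUpTo h g (suc N) = cong (_+_ (h (g 0))) (foldr-applyUpTo h (λ a → g (suc a)) N)

sgn-suc : ∀ N → sgn (suc N) ≡ - sgn N
sgn-suc zero          = refl
sgn-suc (suc zero)    = refl
sgn-suc (suc (suc N)) = sgn-suc N

alternating-telescope : ∀ N (p q : ℕ → ℤ) → (∀ a → a < N → q (suc a) ≡ p a) →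
                        sumTo (λ a → sgn (N ∸ a) * (p a + q a)) (suc N) ≡ p N + sgn N * q 0
alternating-telescope zero p q _ =
  solve 2 (λ x y → con (+ 1) :* (x :+ y) :+ con (+ 0) := x :+ con (+ 1) :* y) refl (p 0) (q 0)
alternating-telescope (suc N) p q shift = begin
  sgn (suc N) * (p 0 + q 0) + sumTo (λ a → sgn (N ∸ a) * (p (suc a) + q (suc a))) (suc N)
    ≡⟨ cong₂ (λ s t → s * (p 0 + q 0) + t) (sgn-suc N)
             (alternating-telescope N (λ a → p (suc a)) (λ a → q (suc a))
                                    (λ a a<N → shift (suc a) (s≤s a<N))) ⟩
  (- sgn N) * (p 0 + q 0) + (p (suc N) + sgn N * q 1)
    ≡⟨ cong (λ t → (- sgn N) * (p 0 + q 0) + (p (suc N) + sgn N * t)) (shift 0 (s≤s z≤n)) ⟩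
  (- sgn N) * (p 0 + q 0) + (p (suc N) + sgn N * p 0)
    ≡⟨ solve 4 (λ S x y z → (:- S) :* (x :+ y) :+ (z :+ S :* x) := z :+ (:- S) :* y)
               refl (sgn N) (p 0) (q 0) (p (suc N)) ⟩
  p (suc N) + (- sgn N) * q 0
    ≡⟨ cong (λ s → p (suc N) + s * q 0) (sym (sgn-suc N)) ⟩
  p (suc N) + sgn (suc N) * q 0 ∎
  where open ≡-Reasoning

-- The character has no x₁-terms after substituting x₂ = −x₁

module _ {n m} (wt : Fin m → Fin (suc (suc n)) → ℕ)
         (G : GLCrystal (suc (suc n)) (Fin m) wt) (Q : QExtra (suc (suc n)) (Fin m) wt G) where
  open QExtra Q

  α₁ : Fin (suc (suc n)) → ℤ
  α₁ = root 0

  e̅-shifts : Shifts wt e̅ α₁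
  e̅-shifts = step⇒shifts wt e̅ 0 e̅-wt

  f̅-shifts : Shifts wt f̅ (λ j → - α₁ j)
  f̅-shifts = inverse-shifts wt e̅ f̅ α₁ e̅f̅ e̅-shifts

  exactly-one-defined : ∀ b → (wt b ! 0 ≢ 0) ⊎ (wt b ! 1 ≢ 0) → is-just (f̅ b) ≡ not (is-just (e̅ b))
  exactly-one-defined b nonzero
    rewrite maxIter-defined e̅ b (ε̅ b) (ε̅-max b) | maxIter-defined f̅ b (φ̅ b) (φ̅-max b) =
    sum-one (ε̅ b) (φ̅ b) (ε̅φ̅≡1 b nonzero)
    where
    sum-one : ∀ x y → x ℕ.+ y ≡ 1 → (1 ℕ.≤ᵇ y) ≡ not (1 ℕ.≤ᵇ x)
    sum-one zero          y       refl = refl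
    sum-one (suc zero)    zero    _    = refl

  module _ (k : ℕ) (c : Fin n → ℕ) where
    K : ℕ
    K = suc k

    -- the exponents x₁^a x₂^{K−a} x^c of the coefficient of x₁^K x^c
    line : ℕ → Fin (suc (suc n)) → ℕ
    line a = a ∷ (K ∸ a) ∷ c

    line-step : ∀ a → a < K → ∀ j → + line (suc a) j ≡ + line a j + α₁ j
    line-step a a<K       zero          = cong +_ (ℕP.+-comm 1 a)
    line-step a (s≤s a≤k) (suc zero)    = sym (cong (λ t → + t + α₁ (suc zero)) (ℕP.+-∸-assoc 1 a≤k))
    line-step a a<K       (suc (suc j)) = cong +_ (sym (ℕP.+-identityʳ (c j)))

    Up Down : ℕ → ℕ
    Up   a = count (λ b → fibre wt (line a) b ∧ is-just (e̅ b))
    Down a = count (λ b → fibre wt (line a) b ∧ is-just (f̅ b))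

    line-nonzero : ∀ a b → fibre wt (line a) b ≡ true → (wt b ! 0 ≢ 0) ⊎ (wt b ! 1 ≢ 0)
    line-nonzero zero    b inFibre =
      inj₂ (λ w₂≡0 → ℕP.0≢1+n (trans (sym w₂≡0) (fibre-weight wt (line 0) b inFibre (suc zero))))
    line-nonzero (suc a) b inFibre =
      inj₁ (λ w₁≡0 → ℕP.0≢1+n (trans (sym w₁≡0) (fibre-weight wt (line (suc a)) b inFibre zero)))

    fibre-splits : ∀ a → count (fibre wt (line a)) ≡ Up a ℕ.+ Down a
    fibre-splits a = trans (count-split (fibre wt (line a)) (λ b → is-just (e̅ b)))
                           (cong (Up a ℕ.+_) (count-cong _ _ not-e̅⇒f̅))
      where
      not-e̅⇒f̅ : ∀ b → fibre wt (line a) b ∧ not (is-just (e̅ b))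
                    ≡ fibre wt (line a) b ∧ is-just (f̅ b)
      not-e̅⇒f̅ b with fibre wt (line a) b in inFibre
      ... | false = refl
      ... | true  = sym (exactly-one-defined b (line-nonzero a b inFibre))

    -- e̅ and f̅ are mutually inverse bijections between consecutive points
    Down-suc≡Up : ∀ a → a < K → Down (suc a) ≡ Up a
    Down-suc≡Up a a<K = ℕP.≤-antisym
      (defined-fibre-≤ wt f̅ e̅ (λ j → - α₁ j) (inverse-sym e̅ f̅ e̅f̅) f̅-shifts (line (suc a)) (line a)
         (λ j → shift-back (+ line a j) (+ line (suc a) j) (α₁ j) (line-step a a<K j)))
      (defined-fibre-≤ wt e̅ f̅ α₁ e̅f̅ e̅-shifts (line a) (line (suc a)) (line-step a a<K))

    -- at the end points e̅, resp. f̅, would produce a negative exponent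
    Up-top : Up K ≡ 0
    Up-top = count-undefined wt _ e̅ λ b inFibre →
      shift-blocked wt e̅ α₁ e̅-shifts b (suc zero) 0
        (cong (λ t → + t + α₁ (suc zero))
              (trans (fibre-weight wt (line K) b inFibre (suc zero)) (ℕP.n∸n≡0 K)))

    Down-bottom : Down 0 ≡ 0
    Down-bottom = count-undefined wt _ f̅ λ b inFibre →
      shift-blocked wt f̅ (λ j → - α₁ j) f̅-shifts b zero 0
        (cong (λ t → + t - α₁ zero) (fibre-weight wt (line 0) b inFibre zero))

    -- the coefficient telescopes: Σ (−1)^{K−a} (Up a + Down a) = Up K ± Down 0 = 0
    substCoeff-vanishes : substCoeff (ch wt) K c ≡ + 0
    substCoeff-vanishes = begin
      substCoeff (ch wt) K c
        ≡⟨ foldr-applyUpTo (λ a → sgn (K ∸ a) * ch wt (line a)) (λ a → a) (suc K) ⟩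
      sumTo (λ a → sgn (K ∸ a) * ch wt (line a)) (suc K)
        ≡⟨ sumTo-cong _ _ (suc K) (λ a → cong (sgn (K ∸ a) *_) (coefficient a)) ⟩
      sumTo (λ a → sgn (K ∸ a) * (+ Up a + + Down a)) (suc K)
        ≡⟨ alternating-telescope K (λ a → + Up a) (λ a → + Down a)
                                 (λ a a<K → cong +_ (Down-suc≡Up a a<K)) ⟩
      + Up K + sgn K * + Down 0
        ≡⟨ cong₂ (λ u d → + u + sgn K * + d) Up-top Down-bottom ⟩
      + 0 + sgn K * + 0
        ≡⟨ cong (_+_ (+ 0)) (ℤP.*-zeroʳ (sgn K)) ⟩
      + 0 ∎
      where
      open ≡-Reasoning
      coefficient : ∀ a → ch wt (line a) ≡ + Up a + + Down a
      coefficient a = trans (ch-as-count wt (line a)) (cong +_ (fibre-splits a))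

-- For n = 1 there are no transpositions; for n ≥ 2 both halves were shown above.
proposition2p5 : (n : ℕ) → 1 ≤ n → (m : ℕ) (wt : Fin m → Fin n → ℕ) →
                 QCrystal n (Fin m) wt → InΓ n (ch wt)
proposition2p5 zero          ()
proposition2p5 (suc zero)    _ m wt _       = swapInvariant⇒symmetric (ch wt) (ch-respects wt) (λ { i (s≤s ()) })
proposition2p5 (suc (suc n)) _ m wt (G , Q) =
  swapInvariant⇒symmetric (ch wt) (ch-respects wt) (ch-swapInvariant wt G) ,
  substCoeff-vanishes wt G Q
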